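{- Let $\mathcal{R}$ be a region and $w\in\{e_x,e_y,e_z\}$, and let $r:\mathbb{R}^3\to\mathbb{R}^3$, $r(p)=p-2(p\cdot w)w$. If $t$ is a tiling of $\mathcal{R}$ and $u\in\Phi$, then the tiling $r(t)=\{r(d): d\in t\}$ of the region $r(\mathcal{R})$ satisfies $T^u(r(t))=-T^u(t)$.
   Context: A basic cube is $[x,x+1]\times[y,y+1]\times[z,z+1]$, $(x,y,z)\in\mathbb{Z}^3$; white if $x+y+z$ even, black if odd. A region is a finite union of basic cubes; a domino is the union of two basic cubes sharing a face; a tiling is a covering by dominoes with pairwise disjoint interiors. $\Phi=\{\pm e_x,\pm e_y,\pm e_z\}$. For a domino $d$, $v(d)\in\Phi$ is the center of its black cube minus the center of its white cube. For $X\subset\mathbb{R}^3$, $u\in\Phi$, $S^u(X)$ is the interior of $(X+[0,\infty)u)\setminus X$. For dominoes $d_0,d_1$: $\tau^u(d_0,d_1)=\tfrac14\det(v(d_1),v(d_0),u)$ if $d_1\cap S^u(d_0)\neq\emptyset$, else $0$. The $u$-pretwist of a tiling $t$ is $T^u(t)=\sum_{d_0,d_1\in t}\tau^u(d_0,d_1)$ over ordered pairs. -}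

module Defs where

open import Data.Bool using (Bool; true; false; if_then_else_)
open import Data.Nat as ℕ using (ℕ; _%_; _≡ᵇ_)
open import Data.Integer as ℤ using (ℤ; +_; -_; _-_; ∣_∣; _+_; _*_)
import Data.Integer.Properties as ℤP
open import Data.Rational as ℚ using (ℚ; 0ℚ; _/_)
open import Data.Product using (_×_; _,_; Σ; ∃; ∃-syntax; proj₁; proj₂)
open import Data.Product.Properties using (≡-dec)
open import Data.List using (List; []; _∷_; foldr; map; concatMap)
open import Data.List.Relation.Unary.Any using (Any; any?)
open import Data.List.Relation.Unary.All using (All)
open import Data.List.Relation.Unary.Unique.Propositional using (Unique)
open import Relation.Nullary using (Dec; yes; no; ¬_; does)
open import Relation.Nullary.Decidable using (_×-dec_; ¬?)
open import Relation.Binary.Definitions using (DecidableEquality)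
open import Relation.Binary.PropositionalEquality
  using (_≡_; refl; sym; trans; cong; subst)

-- Integer points / vectors of ℤ³, and basic cubes.
-- A basic cube [x,x+1]×[y,y+1]×[z,z+1] is represented by its lower
-- corner (x , y , z).

Vec3 : Set
Vec3 = ℤ × ℤ × ℤ

Cube : Set
Cube = Vec3

_≟c_ : DecidableEquality Cube
_≟c_ = ≡-dec ℤP._≟_ (≡-dec ℤP._≟_ ℤP._≟_)

_-v_ : Vec3 → Vec3 → Vec3
(a , b , c) -v (a' , b' , c') = (a - a') , (b - b') , (c - c')

isWhite : Cube → Bool
isWhite (x , y , z) = (∣ x + y + z ∣ % 2) ≡ᵇ 0

-- Directions: Φ = {±e_x, ±e_y, ±e_z}.

data Axis : Set where
  ax ay az : Axis

data Sign : Set where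
  plus minus : Sign

record Dir : Set where
  constructor dir
  field
    axis : Axis
    sign : Sign

signed : Sign → ℤ → ℤ
signed plus  i = i
signed minus i = - i

vec : Dir → Vec3
vec (dir ax s) = signed s (+ 1) , + 0 , + 0
vec (dir ay s) = + 0 , signed s (+ 1) , + 0
vec (dir az s) = + 0 , + 0 , signed s (+ 1)

coord : Axis → Vec3 → ℤ
coord ax (x , y , z) = x
coord ay (x , y , z) = y
coord az (x , y , z) = z

shift : Dir → ℕ → Cube → Cube
shift (dir ax s) k (x , y , z) = (x + signed s (+ k)) , y , z
shift (dir ay s) k (x , y , z) = x , (y + signed s (+ k)) , z
shift (dir az s) k (x , y , z) = x , y , (z + signed s (+ k))

Ray : Dir → Cube → Cube → Set
Ray u c c' = ∃[ k ] (c' ≡ shift u k c)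

private
  +-sub : ∀ x y → (x + y) - x ≡ y
  +-sub x y = trans (cong (_+ (- x)) (ℤP.+-comm x y))
             (trans (ℤP.+-assoc y x (- x))
             (trans (cong (λ i → y + i) (ℤP.+-inverseʳ x)) (ℤP.+-identityʳ y)))

  coord-shift : ∀ a s k c → coord a (shift (dir a s) k c) ≡ coord a c + signed s (+ k)
  coord-shift ax s k (x , y , z) = refl
  coord-shift ay s k (x , y , z) = refl
  coord-shift az s k (x , y , z) = refl

  ∣signed∣ : ∀ s k → ∣ signed s (+ k) ∣ ≡ k
  ∣signed∣ plus  k = refl
  ∣signed∣ minus k = ℤP.∣-i∣≡∣i∣ (+ k)

  ray-k : ∀ a s k c c' → c' ≡ shift (dir a s) k c →
          ∣ coord a c' - coord a c ∣ ≡ k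
  ray-k a s k c c' refl =
    trans (cong (λ i → ∣ i - coord a c ∣) (coord-shift a s k c))
    (trans (cong ∣_∣ (+-sub (coord a c) (signed s (+ k)))) (∣signed∣ s k))

ray? : ∀ u c c' → Dec (Ray u c c')
ray? (dir a s) c c' with c' ≟c shift (dir a s) ∣ coord a c' - coord a c ∣ c
... | yes p = yes (_ , p)
... | no ¬p = no λ { (k , q) →
  ¬p (subst (λ n → c' ≡ shift (dir a s) n c) (sym (ray-k a s k c c' q)) q) }

-- Dominoes.  A domino is represented by the (ordered) pair of its two
-- cubes; it is a genuine domino when the cubes share a face.

Domino : Set
Domino = Cube × Cube

cubes : Domino → List Cube
cubes (a , b) = a ∷ b ∷ []

IsDomino : Domino → Set
IsDomino (a , b) = ∃[ φ ] (b ≡ shift φ 1 a)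

-- v(d) = centre of black cube − centre of white cube
v : Domino → Vec3
v (a , b) = if isWhite a then b -v a else a -v b

-- A tiling of R is a finite family of dominoes with pairwise disjoint
-- interiors (= no basic cube is used twice) whose union is R.

Region : Set
Region = List Cube

_∈_ : Cube → List Cube → Set
c ∈ xs = Any (c ≡_) xs

_∉_ : Cube → List Cube → Set
c ∉ xs = ¬ (c ∈ xs)

_∈?_ : ∀ c xs → Dec (c ∈ xs)
c ∈? xs = any? (c ≟c_) xs

IsTiling : Region → List Domino → Set
IsTiling R t =
  All IsDomino t ×
  Unique (concatMap cubes t) ×
  (∀ c → c ∈ concatMap cubes t → c ∈ R) ×
  (∀ c → c ∈ R → c ∈ concatMap cubes t)

-- Reflection r(p) = p − 2(p·w)w, w ∈ {e_x,e_y,e_z}, acting on cubes: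
-- the cube with lower corner x along w is sent to [−x−1, −x], i.e. to
-- the cube with lower corner −x−1 along w.

refl1 : ℤ → ℤ
refl1 x = - x - + 1

reflectCube : Axis → Cube → Cube
reflectCube ax (x , y , z) = refl1 x , y , z
reflectCube ay (x , y , z) = x , refl1 y , z
reflectCube az (x , y , z) = x , y , refl1 z

reflectDomino : Axis → Domino → Domino
reflectDomino w (a , b) = reflectCube w a , reflectCube w b

reflectTiling : Axis → List Domino → List Domino
reflectTiling w t = map (reflectDomino w) t

-- Shadows.  d₁ ∩ S^u(d₀) ≠ ∅, where S^u(X) is the interior of
-- (X + [0,∞)u) ∖ X, holds exactly when some basic cube of d₁ is of the
-- form c + k u (c a cube of d₀, k ∈ ℕ) and is not a cube of d₀.

Shadow : Dir → Domino → Domino → Set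
Shadow u d₀ d₁ =
  Any (λ c' → Any (λ c → Ray u c c') (cubes d₀) × c' ∉ cubes d₀) (cubes d₁)

shadow? : ∀ u d₀ d₁ → Dec (Shadow u d₀ d₁)
shadow? u d₀ d₁ =
  any? (λ c' → any? (λ c → ray? u c c') (cubes d₀) ×-dec ¬? (c' ∈? cubes d₀))
       (cubes d₁)

det : Vec3 → Vec3 → Vec3 → ℤ
det (a₁ , a₂ , a₃) (b₁ , b₂ , b₃) (c₁ , c₂ , c₃) =
    a₁ * (b₂ * c₃ - b₃ * c₂)
  - a₂ * (b₁ * c₃ - b₃ * c₁)
  + a₃ * (b₁ * c₂ - b₂ * c₁)

τ : Dir → Domino → Domino → ℚ
τ u d₀ d₁ = if does (shadow? u d₀ d₁) then det (v d₁) (v d₀) (vec u) / 4 else 0ℚ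

sumℚ : List ℚ → ℚ
sumℚ = foldr ℚ._+_ 0ℚ

pretwist : Dir → List Domino → ℚ
pretwist u t = sumℚ (map (λ d₀ → sumℚ (map (λ d₁ → τ u d₀ d₁) t)) t)

-- The reflection r maps the ray from c in direction u to the ray from r c in
-- direction r u, so it carries shadows to shadows. It also swaps the two
-- colours, so v (r d) = −M (v d) where M = mirror w is the linear part of r,
-- of determinant −1; hence τ^u(r d₀, r d₁) = −τ^{r u}(d₀, d₁) and
-- T^u(r t) = −T^{r u}(t). Either r u = u and we are done, or r u = −u. In the
-- latter case T^{−u}(t) = T^u(t): for disjoint dominoes, d₁ meets S^{−u}(d₀)
-- iff d₀ meets S^u(d₁), and det(v d₁, v d₀, −u) = det(v d₀, v d₁, u), so
-- τ^{−u}(d₀, d₁) = τ^u(d₁, d₀), while τ vanishes on the diagonal.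
module Submission where

open import Defs
open import Data.List using (List)
open import Data.Rational using (-_)
open import Relation.Binary.PropositionalEquality using (_≡_)

open import Algebra.Bundles using (CommutativeMonoid)
open import Algebra.Properties.CommutativeSemigroup using (interchange)
open import Algebra.Properties.Group using (⁻¹-involutive)
open import Data.Bool using (Bool; true; false; not; _xor_; if_then_else_)
open import Data.Bool.Properties
  using (not-involutive; not-distribˡ-xor; not-distribʳ-xor; xor-assoc; xor-comm; xor-identityʳ)
open import Data.Integer as ℤ using (ℤ; +_; +[1+_]; -[1+_]; ∣_∣; _+_; _-_)
import Data.Integer.Properties as ℤ
open import Data.Integer.Solver using (module +-*-Solver)
open +-*-Solver using (Polynomial; con; _:+_; _:-_; :-_; _:*_; _:=_; solve)
open import Data.List using ([]; _∷_; map; concatMap)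
import Data.List.Properties as List
open import Data.List.Membership.Propositional using (find; lose) renaming (_∈_ to _∈ₗ_)
open import Data.List.Membership.Propositional.Properties using (∈-concatMap⁺)
import Data.List.Relation.Unary.All as All
open import Data.List.Relation.Unary.Any as Any using (Any; here; there)
import Data.List.Relation.Unary.Any.Properties as Any
open import Data.List.Relation.Unary.AllPairs using (_∷_)
open import Data.List.Relation.Unary.Unique.Propositional using (Unique)
open import Data.Nat as ℕ using (ℕ; zero; suc)
import Data.Nat.Properties as ℕ
open import Data.Product using (_×_; _,_)
open import Data.Rational as ℚ using (ℚ; 0ℚ; _/_)
import Data.Rational.Properties as ℚ
open import Data.Sum using (_⊎_; inj₁; inj₂)
open import Function.Bundles using (mk⇔)
open import Relation.Nullary.Decidable using (does; does-⇔)
open import Relation.Binary.PropositionalEquality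
  using (refl; sym; trans; cong; cong₂; subst; subst₂; module ≡-Reasoning)
open import Data.Integer.Tactic.RingSolver using (solve-∀)

open ≡-Reasoning

flipSign : Sign → Sign
flipSign plus  = minus
flipSign minus = plus

signed-flipSign : ∀ s i → signed (flipSign s) i ≡ ℤ.- signed s i
signed-flipSign plus  i = refl
signed-flipSign minus i = sym (ℤ.neg-involutive i)

opposite : Dir → Dir
opposite (dir a s) = dir a (flipSign s)

opposite-involutive : ∀ u → opposite (opposite u) ≡ u
opposite-involutive (dir a plus)  = refl
opposite-involutive (dir a minus) = refl

reflectDir : Axis → Dir → Dir
reflectDir ax u@(dir ax _) = opposite u
reflectDir ay u@(dir ay _) = opposite u
reflectDir az u@(dir az _) = opposite u
reflectDir _  u            = u

reflectDir-involutive : ∀ w u → reflectDir w (reflectDir w u) ≡ u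
reflectDir-involutive ax (dir ax s) = opposite-involutive (dir ax s)
reflectDir-involutive ax (dir ay s) = refl
reflectDir-involutive ax (dir az s) = refl
reflectDir-involutive ay (dir ax s) = refl
reflectDir-involutive ay (dir ay s) = opposite-involutive (dir ay s)
reflectDir-involutive ay (dir az s) = refl
reflectDir-involutive az (dir ax s) = refl
reflectDir-involutive az (dir ay s) = refl
reflectDir-involutive az (dir az s) = opposite-involutive (dir az s)

reflectDir-fixes-or-reverses : ∀ w u → reflectDir w u ≡ u ⊎ reflectDir w u ≡ opposite u
reflectDir-fixes-or-reverses ax (dir ax s) = inj₂ refl
reflectDir-fixes-or-reverses ax (dir ay s) = inj₁ refl
reflectDir-fixes-or-reverses ax (dir az s) = inj₁ refl
reflectDir-fixes-or-reverses ay (dir ax s) = inj₁ refl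
reflectDir-fixes-or-reverses ay (dir ay s) = inj₂ refl
reflectDir-fixes-or-reverses ay (dir az s) = inj₁ refl
reflectDir-fixes-or-reverses az (dir ax s) = inj₁ refl
reflectDir-fixes-or-reverses az (dir ay s) = inj₁ refl
reflectDir-fixes-or-reverses az (dir az s) = inj₂ refl

neg : Vec3 → Vec3
neg (a , b , c) = ℤ.- a , ℤ.- b , ℤ.- c

mirror : Axis → Vec3 → Vec3
mirror ax (a , b , c) = ℤ.- a , b , c
mirror ay (a , b , c) = a , ℤ.- b , c
mirror az (a , b , c) = a , b , ℤ.- c

mirror-involutive : ∀ w x → mirror w (mirror w x) ≡ x
mirror-involutive ax (a , b , c) = cong (_, b , c) (ℤ.neg-involutive a)
mirror-involutive ay (a , b , c) = cong (λ b' → a , b' , c) (ℤ.neg-involutive b)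
mirror-involutive az (a , b , c) = cong (λ c' → a , b , c') (ℤ.neg-involutive c)

-v-antisym : ∀ x y → x -v y ≡ neg (y -v x)
-v-antisym (a , b , c) (a' , b' , c') =
  cong₂ _,_ (minus-antisym a a') (cong₂ _,_ (minus-antisym b b') (minus-antisym c c'))
  where
  minus-antisym : ∀ i j → i - j ≡ ℤ.- (j - i)
  minus-antisym = solve-∀

vec-opposite : ∀ u → vec (opposite u) ≡ neg (vec u)
vec-opposite (dir ax s) = cong (_, + 0 , + 0) (signed-flipSign s (+ 1))
vec-opposite (dir ay s) = cong (λ i → + 0 , i , + 0) (signed-flipSign s (+ 1))
vec-opposite (dir az s) = cong (λ i → + 0 , + 0 , i) (signed-flipSign s (+ 1))

vec-reflectDir : ∀ w u → vec (reflectDir w u) ≡ mirror w (vec u)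
vec-reflectDir ax (dir ax s) = vec-opposite (dir ax s)
vec-reflectDir ax (dir ay s) = refl
vec-reflectDir ax (dir az s) = refl
vec-reflectDir ay (dir ax s) = refl
vec-reflectDir ay (dir ay s) = vec-opposite (dir ay s)
vec-reflectDir ay (dir az s) = refl
vec-reflectDir az (dir ax s) = refl
vec-reflectDir az (dir ay s) = refl
vec-reflectDir az (dir az s) = vec-opposite (dir az s)

-- det as a ring-solver polynomial: its semantics unfolds to det, so the
-- identities below are instances of ring identities.
Poly³ : ℕ → Set
Poly³ n = Polynomial n × Polynomial n × Polynomial n

detₚ : ∀ {n} → Poly³ n → Poly³ n → Poly³ n → Polynomial n
detₚ (a₁ , a₂ , a₃) (b₁ , b₂ , b₃) (c₁ , c₂ , c₃) =
     a₁ :* (b₂ :* c₃ :- b₃ :* c₂)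
  :- a₂ :* (b₁ :* c₃ :- b₃ :* c₁)
  :+ a₃ :* (b₁ :* c₂ :- b₂ :* c₁)

det-mirror : ∀ w x y z → det (mirror w x) (mirror w y) (mirror w z) ≡ ℤ.- det x y z
det-mirror ax (a₁ , a₂ , a₃) (b₁ , b₂ , b₃) (c₁ , c₂ , c₃) =
  solve 9 (λ a₁ a₂ a₃ b₁ b₂ b₃ c₁ c₂ c₃ →
             detₚ (:- a₁ , a₂ , a₃) (:- b₁ , b₂ , b₃) (:- c₁ , c₂ , c₃)
          := :- detₚ (a₁ , a₂ , a₃) (b₁ , b₂ , b₃) (c₁ , c₂ , c₃))
        refl a₁ a₂ a₃ b₁ b₂ b₃ c₁ c₂ c₃
det-mirror ay (a₁ , a₂ , a₃) (b₁ , b₂ , b₃) (c₁ , c₂ , c₃) =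
  solve 9 (λ a₁ a₂ a₃ b₁ b₂ b₃ c₁ c₂ c₃ →
             detₚ (a₁ , :- a₂ , a₃) (b₁ , :- b₂ , b₃) (c₁ , :- c₂ , c₃)
          := :- detₚ (a₁ , a₂ , a₃) (b₁ , b₂ , b₃) (c₁ , c₂ , c₃))
        refl a₁ a₂ a₃ b₁ b₂ b₃ c₁ c₂ c₃
det-mirror az (a₁ , a₂ , a₃) (b₁ , b₂ , b₃) (c₁ , c₂ , c₃) =
  solve 9 (λ a₁ a₂ a₃ b₁ b₂ b₃ c₁ c₂ c₃ →
             detₚ (a₁ , a₂ , :- a₃) (b₁ , b₂ , :- b₃) (c₁ , c₂ , :- c₃)
          := :- detₚ (a₁ , a₂ , a₃) (b₁ , b₂ , b₃) (c₁ , c₂ , c₃))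
        refl a₁ a₂ a₃ b₁ b₂ b₃ c₁ c₂ c₃

det-neg-neg : ∀ x y z → det (neg x) (neg y) z ≡ det x y z
det-neg-neg (a₁ , a₂ , a₃) (b₁ , b₂ , b₃) (c₁ , c₂ , c₃) =
  solve 9 (λ a₁ a₂ a₃ b₁ b₂ b₃ c₁ c₂ c₃ →
             detₚ (:- a₁ , :- a₂ , :- a₃) (:- b₁ , :- b₂ , :- b₃) (c₁ , c₂ , c₃)
          := detₚ (a₁ , a₂ , a₃) (b₁ , b₂ , b₃) (c₁ , c₂ , c₃))
        refl a₁ a₂ a₃ b₁ b₂ b₃ c₁ c₂ c₃

det-swap-neg : ∀ x y z → det y x (neg z) ≡ det x y z
det-swap-neg (a₁ , a₂ , a₃) (b₁ , b₂ , b₃) (c₁ , c₂ , c₃) =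
  solve 9 (λ a₁ a₂ a₃ b₁ b₂ b₃ c₁ c₂ c₃ →
             detₚ (b₁ , b₂ , b₃) (a₁ , a₂ , a₃) (:- c₁ , :- c₂ , :- c₃)
          := detₚ (a₁ , a₂ , a₃) (b₁ , b₂ , b₃) (c₁ , c₂ , c₃))
        refl a₁ a₂ a₃ b₁ b₂ b₃ c₁ c₂ c₃

det-self : ∀ x z → det x x z ≡ + 0
det-self (a₁ , a₂ , a₃) (c₁ , c₂ , c₃) =
  solve 6 (λ a₁ a₂ a₃ c₁ c₂ c₃ →
             detₚ (a₁ , a₂ , a₃) (a₁ , a₂ , a₃) (c₁ , c₂ , c₃) := con (+ 0))
        refl a₁ a₂ a₃ c₁ c₂ c₃

det-mirror₁₂ : ∀ w x y z → det (mirror w x) (mirror w y) z ≡ ℤ.- det x y (mirror w z)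
det-mirror₁₂ w x y z = begin
  det (mirror w x) (mirror w y) z
    ≡⟨ cong (det (mirror w x) (mirror w y)) (sym (mirror-involutive w z)) ⟩
  det (mirror w x) (mirror w y) (mirror w (mirror w z))
    ≡⟨ det-mirror w x y (mirror w z) ⟩
  ℤ.- det x y (mirror w z) ∎

refl1-involutive : ∀ x → refl1 (refl1 x) ≡ x
refl1-involutive = solve 1 (λ x → :- (:- x :- con (+ 1)) :- con (+ 1) := x) refl

refl1-+ : ∀ x j → refl1 (x + j) ≡ refl1 x - j
refl1-+ = solve 2 (λ x j → :- (x :+ j) :- con (+ 1) := (:- x :- con (+ 1)) :- j) refl

refl1-- : ∀ x y → refl1 x - refl1 y ≡ ℤ.- (x - y)
refl1-- = solve 2 (λ x y → (:- x :- con (+ 1)) :- (:- y :- con (+ 1)) := :- (x :- y)) refl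

reflectCube-involutive : ∀ w c → reflectCube w (reflectCube w c) ≡ c
reflectCube-involutive ax (x , y , z) = cong (_, y , z) (refl1-involutive x)
reflectCube-involutive ay (x , y , z) = cong (λ y' → x , y' , z) (refl1-involutive y)
reflectCube-involutive az (x , y , z) = cong (λ z' → x , y , z') (refl1-involutive z)

reflectCube-injective : ∀ w {c c'} → reflectCube w c ≡ reflectCube w c' → c ≡ c'
reflectCube-injective w {c} {c'} eq = begin
  c                                 ≡⟨ reflectCube-involutive w c ⟨
  reflectCube w (reflectCube w c)   ≡⟨ cong (reflectCube w) eq ⟩
  reflectCube w (reflectCube w c')  ≡⟨ reflectCube-involutive w c' ⟩
  c'                                ∎

reflectDomino-involutive : ∀ w d → reflectDomino w (reflectDomino w d) ≡ d
reflectDomino-involutive w (a , b) =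
  cong₂ _,_ (reflectCube-involutive w a) (reflectCube-involutive w b)

reflectCube-sub : ∀ w c c' → reflectCube w c -v reflectCube w c' ≡ mirror w (c -v c')
reflectCube-sub ax (x , y , z) (x' , y' , z') = cong (_, y - y' , z - z') (refl1-- x x')
reflectCube-sub ay (x , y , z) (x' , y' , z') = cong (λ i → x - x' , i , z - z') (refl1-- y y')
reflectCube-sub az (x , y , z) (x' , y' , z') = cong (λ i → x - x' , y - y' , i) (refl1-- z z')

refl1-+signed : ∀ s x k → refl1 (x + signed s k) ≡ refl1 x + signed (flipSign s) k
refl1-+signed s x k = trans (refl1-+ x (signed s k)) (cong (_+_ (refl1 x)) (sym (signed-flipSign s k)))

reflectCube-shift : ∀ w u k c →
  reflectCube w (shift u k c) ≡ shift (reflectDir w u) k (reflectCube w c)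
reflectCube-shift ax (dir ax s) k (x , y , z) = cong (_, y , z) (refl1-+signed s x (+ k))
reflectCube-shift ax (dir ay s) k (x , y , z) = refl
reflectCube-shift ax (dir az s) k (x , y , z) = refl
reflectCube-shift ay (dir ax s) k (x , y , z) = refl
reflectCube-shift ay (dir ay s) k (x , y , z) = cong (λ y' → x , y' , z) (refl1-+signed s y (+ k))
reflectCube-shift ay (dir az s) k (x , y , z) = refl
reflectCube-shift az (dir ax s) k (x , y , z) = refl
reflectCube-shift az (dir ay s) k (x , y , z) = refl
reflectCube-shift az (dir az s) k (x , y , z) = cong (λ z' → x , y , z') (refl1-+signed s z (+ k))

+signed-cancel : ∀ s x k → x + signed s k + signed (flipSign s) k ≡ x
+signed-cancel s x k = begin
  x + signed s k + signed (flipSign s) k  ≡⟨ cong (_+_ (x + signed s k)) (signed-flipSign s k) ⟩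
  x + signed s k - signed s k             ≡⟨ cancel x (signed s k) ⟩
  x                                       ∎
  where
  cancel : ∀ i j → i + j - j ≡ i
  cancel = solve-∀

shift-opposite-cancel : ∀ u k c → shift (opposite u) k (shift u k c) ≡ c
shift-opposite-cancel (dir ax s) k (x , y , z) = cong (_, y , z) (+signed-cancel s x (+ k))
shift-opposite-cancel (dir ay s) k (x , y , z) = cong (λ y' → x , y' , z) (+signed-cancel s y (+ k))
shift-opposite-cancel (dir az s) k (x , y , z) = cong (λ z' → x , y , z') (+signed-cancel s z (+ k))

Ray-reflect : ∀ w {u c c'} → Ray u c c' → Ray (reflectDir w u) (reflectCube w c) (reflectCube w c')
Ray-reflect w {u} {c} (k , refl) = k , reflectCube-shift w u k c

Ray-opposite : ∀ {u c c'} → Ray u c c' → Ray (opposite u) c' c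
Ray-opposite {u} {c} (k , refl) = k , sym (shift-opposite-cancel u k c)

isOddℕ : ℕ → Bool
isOddℕ n = not (n ℕ.% 2 ℕ.≡ᵇ 0)

isOdd : ℤ → Bool
isOdd i = isOddℕ ∣ i ∣

isOddℕ-suc : ∀ n → isOddℕ (suc n) ≡ not (isOddℕ n)
isOddℕ-suc zero    = refl
isOddℕ-suc (suc n) = sym (trans (cong not (isOddℕ-suc n)) (not-involutive (isOddℕ n)))

isOdd-suc : ∀ i → isOdd (i + + 1) ≡ not (isOdd i)
isOdd-suc (+ n)        = trans (cong isOddℕ (ℕ.+-comm n 1)) (isOddℕ-suc n)
isOdd-suc -[1+ zero ]  = refl
isOdd-suc -[1+ suc n ] = isOddℕ-suc n

isOdd-neg : ∀ i → isOdd (ℤ.- i) ≡ isOdd i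
isOdd-neg i = cong isOddℕ (ℤ.∣-i∣≡∣i∣ i)

isOdd-+ℕ : ∀ i n → isOdd (i + + n) ≡ isOdd i xor isOddℕ n
isOdd-+ℕ i zero    = trans (cong isOdd (ℤ.+-identityʳ i)) (sym (xor-identityʳ (isOdd i)))
isOdd-+ℕ i (suc n) = begin
  isOdd (i + + suc n)                  ≡⟨ cong isOdd (+-suc i (+ n)) ⟩
  isOdd (i + + n + + 1)                ≡⟨ isOdd-suc (i + + n) ⟩
  not (isOdd (i + + n))                ≡⟨ cong not (isOdd-+ℕ i n) ⟩
  not (isOdd i xor isOddℕ n)           ≡⟨ not-distribʳ-xor (isOdd i) (isOddℕ n) ⟩
  isOdd i xor not (isOddℕ n)           ≡⟨ cong (isOdd i xor_) (isOddℕ-suc n) ⟨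
  isOdd i xor isOddℕ (suc n)           ∎
  where
  +-suc : ∀ i j → i + (+ 1 + j) ≡ i + j + + 1
  +-suc = solve-∀

isOdd-+ : ∀ i j → isOdd (i + j) ≡ isOdd i xor isOdd j
isOdd-+ i (+ n)    = isOdd-+ℕ i n
isOdd-+ i -[1+ n ] = begin
  isOdd (i + -[1+ n ])                 ≡⟨ cong isOdd (+-neg i (+ suc n)) ⟩
  isOdd (ℤ.- (ℤ.- i + + suc n))        ≡⟨ isOdd-neg (ℤ.- i + + suc n) ⟩
  isOdd (ℤ.- i + + suc n)              ≡⟨ isOdd-+ℕ (ℤ.- i) (suc n) ⟩
  isOdd (ℤ.- i) xor isOddℕ (suc n)     ≡⟨ cong (_xor isOddℕ (suc n)) (isOdd-neg i) ⟩
  isOdd i xor isOddℕ (suc n)           ∎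
  where
  +-neg : ∀ i j → i + ℤ.- j ≡ ℤ.- (ℤ.- i + j)
  +-neg = solve-∀

isOdd-refl1 : ∀ x → isOdd (refl1 x) ≡ not (isOdd x)
isOdd-refl1 x = begin
  isOdd (ℤ.- x + ℤ.- + 1)     ≡⟨ isOdd-+ (ℤ.- x) (ℤ.- + 1) ⟩
  isOdd (ℤ.- x) xor true      ≡⟨ xor-comm (isOdd (ℤ.- x)) true ⟩
  not (isOdd (ℤ.- x))         ≡⟨ cong not (isOdd-neg x) ⟩
  not (isOdd x)               ∎

isBlack : Cube → Bool
isBlack (x , y , z) = isOdd x xor isOdd y xor isOdd z

isWhite≡not-isBlack : ∀ c → isWhite c ≡ not (isBlack c)
isWhite≡not-isBlack (x , y , z) = begin
  isWhite (x , y , z)                         ≡⟨ not-involutive (isWhite (x , y , z)) ⟨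
  not (isOdd (x + y + z))                     ≡⟨ cong not (isOdd-+ (x + y) z) ⟩
  not (isOdd (x + y) xor isOdd z)             ≡⟨ cong (λ b → not (b xor isOdd z)) (isOdd-+ x y) ⟩
  not ((isOdd x xor isOdd y) xor isOdd z)     ≡⟨ cong not (xor-assoc (isOdd x) (isOdd y) (isOdd z)) ⟩
  not (isBlack (x , y , z))                   ∎

isBlack-reflectCube : ∀ w c → isBlack (reflectCube w c) ≡ not (isBlack c)
isBlack-reflectCube ax (x , y , z) = begin
  isOdd (refl1 x) xor isOdd y xor isOdd z    ≡⟨ cong (_xor (isOdd y xor isOdd z)) (isOdd-refl1 x) ⟩
  not (isOdd x) xor isOdd y xor isOdd z      ≡⟨ not-distribˡ-xor (isOdd x) (isOdd y xor isOdd z) ⟨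
  not (isBlack (x , y , z))                  ∎
isBlack-reflectCube ay (x , y , z) = begin
  isOdd x xor isOdd (refl1 y) xor isOdd z    ≡⟨ cong (λ b → isOdd x xor b xor isOdd z) (isOdd-refl1 y) ⟩
  isOdd x xor not (isOdd y) xor isOdd z      ≡⟨ cong (isOdd x xor_) (not-distribˡ-xor (isOdd y) (isOdd z)) ⟨
  isOdd x xor not (isOdd y xor isOdd z)      ≡⟨ not-distribʳ-xor (isOdd x) (isOdd y xor isOdd z) ⟨
  not (isBlack (x , y , z))                  ∎
isBlack-reflectCube az (x , y , z) = begin
  isOdd x xor isOdd y xor isOdd (refl1 z)    ≡⟨ cong (λ b → isOdd x xor isOdd y xor b) (isOdd-refl1 z) ⟩
  isOdd x xor isOdd y xor not (isOdd z)      ≡⟨ cong (isOdd x xor_) (not-distribʳ-xor (isOdd y) (isOdd z)) ⟨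
  isOdd x xor not (isOdd y xor isOdd z)      ≡⟨ not-distribʳ-xor (isOdd x) (isOdd y xor isOdd z) ⟨
  not (isBlack (x , y , z))                  ∎

isWhite-reflectCube : ∀ w c → isWhite (reflectCube w c) ≡ not (isWhite c)
isWhite-reflectCube w c = begin
  isWhite (reflectCube w c)          ≡⟨ isWhite≡not-isBlack (reflectCube w c) ⟩
  not (isBlack (reflectCube w c))    ≡⟨ cong not (isBlack-reflectCube w c) ⟩
  not (not (isBlack c))              ≡⟨ cong not (isWhite≡not-isBlack c) ⟨
  not (isWhite c)                    ∎

v-reflectDomino : ∀ w d → v (reflectDomino w d) ≡ mirror w (neg (v d))
v-reflectDomino w (a , b) rewrite isWhite-reflectCube w a with isWhite a
... | true  = trans (reflectCube-sub w a b) (cong (mirror w) (-v-antisym a b))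
... | false = trans (reflectCube-sub w b a) (cong (mirror w) (-v-antisym b a))

Shadow-reflect : ∀ w {u} d₀ d₁ →
  Shadow u d₀ d₁ → Shadow (reflectDir w u) (reflectDomino w d₀) (reflectDomino w d₁)
Shadow-reflect w {u} (a₀ , b₀) (a₁ , b₁) s = Any.map⁺ (Any.map reflectWitness s)
  where
  r : Cube → Cube
  r = reflectCube w
  reflectWitness : ∀ {c'} → Any (λ c → Ray u c c') (a₀ ∷ b₀ ∷ []) × c' ∉ (a₀ ∷ b₀ ∷ []) →
    Any (λ c → Ray (reflectDir w u) c (r c')) (map r (a₀ ∷ b₀ ∷ [])) × r c' ∉ map r (a₀ ∷ b₀ ∷ [])
  reflectWitness (ray , c'∉d₀) =
    Any.map⁺ (Any.map (Ray-reflect w) ray) ,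
    λ rc'∈rd₀ → c'∉d₀ (Any.map (reflectCube-injective w) (Any.map⁻ rc'∈rd₀))

Shadow-reflect⁻ : ∀ w {u} d₀ d₁ →
  Shadow u (reflectDomino w d₀) (reflectDomino w d₁) → Shadow (reflectDir w u) d₀ d₁
Shadow-reflect⁻ w d₀ d₁ s =
  subst₂ (Shadow _) (reflectDomino-involutive w d₀) (reflectDomino-involutive w d₁)
         (Shadow-reflect w (reflectDomino w d₀) (reflectDomino w d₁) s)

shadow?-reflect : ∀ w u d₀ d₁ →
  does (shadow? u (reflectDomino w d₀) (reflectDomino w d₁)) ≡ does (shadow? (reflectDir w u) d₀ d₁)
shadow?-reflect w u d₀ d₁ = does-⇔ (mk⇔ (Shadow-reflect⁻ w d₀ d₁) reflectBack)
    (shadow? u (reflectDomino w d₀) (reflectDomino w d₁)) (shadow? (reflectDir w u) d₀ d₁)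
  where
  reflectBack : Shadow (reflectDir w u) d₀ d₁ → Shadow u (reflectDomino w d₀) (reflectDomino w d₁)
  reflectBack s = subst (λ u' → Shadow u' _ _) (reflectDir-involutive w u) (Shadow-reflect w d₀ d₁ s)

Disjoint : Domino → Domino → Set
Disjoint d₀ d₁ = ∀ {c} → c ∈ cubes d₀ → c ∉ cubes d₁

Disjoint-sym : ∀ {d₀ d₁} → Disjoint d₀ d₁ → Disjoint d₁ d₀
Disjoint-sym dis c∈d₁ c∈d₀ = dis c∈d₀ c∈d₁

Shadow-opposite : ∀ {u d₀ d₁} → Disjoint d₀ d₁ → Shadow u d₀ d₁ → Shadow (opposite u) d₁ d₀
Shadow-opposite dis s with find s
... | c' , c'∈d₁ , ray∈ , _ with find ray∈
... | c , c∈d₀ , ray = lose c∈d₀ (lose c'∈d₁ (Ray-opposite ray) , dis c∈d₀)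

shadow?-opposite : ∀ u {d₀ d₁} → Disjoint d₀ d₁ →
  does (shadow? (opposite u) d₀ d₁) ≡ does (shadow? u d₁ d₀)
shadow?-opposite u {d₀} {d₁} dis = does-⇔ (mk⇔ toShadow (Shadow-opposite (Disjoint-sym dis)))
    (shadow? (opposite u) d₀ d₁) (shadow? u d₁ d₀)
  where
  toShadow : Shadow (opposite u) d₀ d₁ → Shadow u d₁ d₀
  toShadow s = subst (λ u' → Shadow u' d₁ d₀) (opposite-involutive u) (Shadow-opposite dis s)

neg-/ : ∀ i n .{{_ : ℕ.NonZero n}} → (ℤ.- i) / n ≡ - (i / n)
neg-/ (+ zero)  n = trans (ℚ.0/n≡0 n) (cong -_ (sym (ℚ.0/n≡0 n)))
neg-/ +[1+ m ]  n = refl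
neg-/ -[1+ m ]  n = sym (⁻¹-involutive ℚ.+-0-group (+[1+ m ] / n))

if-neg : ∀ b q → (if b then - q else 0ℚ) ≡ - (if b then q else 0ℚ)
if-neg true  q = refl
if-neg false q = refl

det-v-reflect : ∀ w u d₀ d₁ →
  det (v (reflectDomino w d₁)) (v (reflectDomino w d₀)) (vec u) ≡
  ℤ.- det (v d₁) (v d₀) (vec (reflectDir w u))
det-v-reflect w u d₀ d₁ = begin
  det (v (reflectDomino w d₁)) (v (reflectDomino w d₀)) (vec u)
    ≡⟨ cong₂ (λ x y → det x y (vec u)) (v-reflectDomino w d₁) (v-reflectDomino w d₀) ⟩
  det (mirror w (neg (v d₁))) (mirror w (neg (v d₀))) (vec u)
    ≡⟨ det-mirror₁₂ w (neg (v d₁)) (neg (v d₀)) (vec u) ⟩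
  ℤ.- det (neg (v d₁)) (neg (v d₀)) (mirror w (vec u))
    ≡⟨ cong ℤ.-_ (det-neg-neg (v d₁) (v d₀) (mirror w (vec u))) ⟩
  ℤ.- det (v d₁) (v d₀) (mirror w (vec u))
    ≡⟨ cong (λ z → ℤ.- det (v d₁) (v d₀) z) (vec-reflectDir w u) ⟨
  ℤ.- det (v d₁) (v d₀) (vec (reflectDir w u)) ∎

τ-reflect : ∀ w u d₀ d₁ →
  τ u (reflectDomino w d₀) (reflectDomino w d₁) ≡ - τ (reflectDir w u) d₀ d₁
τ-reflect w u d₀ d₁ = begin
  τ u (reflectDomino w d₀) (reflectDomino w d₁)
    ≡⟨ cong₂ (λ b i → if b then i / 4 else 0ℚ) (shadow?-reflect w u d₀ d₁) (det-v-reflect w u d₀ d₁) ⟩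
  (if inShadow then (ℤ.- D) / 4 else 0ℚ)
    ≡⟨ cong (λ q → if inShadow then q else 0ℚ) (neg-/ D 4) ⟩
  (if inShadow then - (D / 4) else 0ℚ)
    ≡⟨ if-neg inShadow (D / 4) ⟩
  - τ (reflectDir w u) d₀ d₁ ∎
  where
  inShadow : Bool
  inShadow = does (shadow? (reflectDir w u) d₀ d₁)
  D : ℤ
  D = det (v d₁) (v d₀) (vec (reflectDir w u))

τ-diagonal : ∀ u d → τ u d d ≡ 0ℚ
τ-diagonal u d with does (shadow? u d d)
... | true  = cong (_/ 4) (det-self (v d) (vec u))
... | false = refl

τ-opposite : ∀ u {d₀ d₁} → d₀ ≡ d₁ ⊎ Disjoint d₀ d₁ → τ (opposite u) d₀ d₁ ≡ τ u d₁ d₀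
τ-opposite u {d} (inj₁ refl) = trans (τ-diagonal (opposite u) d) (sym (τ-diagonal u d))
τ-opposite u {d₀} {d₁} (inj₂ dis) =
  cong₂ (λ b i → if b then i / 4 else 0ℚ) (shadow?-opposite u dis) (begin
    det (v d₁) (v d₀) (vec (opposite u))   ≡⟨ cong (det (v d₁) (v d₀)) (vec-opposite u) ⟩
    det (v d₁) (v d₀) (neg (vec u))        ≡⟨ det-swap-neg (v d₀) (v d₁) (vec u) ⟩
    det (v d₀) (v d₁) (vec u)              ∎)

sumOver : {A : Set} → (A → ℚ) → List A → ℚ
sumOver f xs = sumℚ (map f xs)

sumOver-map : ∀ {A B : Set} (f : B → ℚ) (g : A → B) xs →
  sumOver f (map g xs) ≡ sumOver (λ x → f (g x)) xs
sumOver-map f g xs = cong sumℚ (sym (List.map-∘ xs))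

sumOver-cong : ∀ {A : Set} {f g : A → ℚ} xs →
  (∀ {x} → x ∈ₗ xs → f x ≡ g x) → sumOver f xs ≡ sumOver g xs
sumOver-cong xs f≗g = cong sumℚ (List.map-cong-local (All.tabulate f≗g))

sumOver-neg : ∀ {A : Set} (f : A → ℚ) xs → sumOver (λ x → - f x) xs ≡ - sumOver f xs
sumOver-neg f []       = refl
sumOver-neg f (x ∷ xs) = begin
  - f x ℚ.+ sumOver (λ x → - f x) xs  ≡⟨ cong (ℚ._+_ (- f x)) (sumOver-neg f xs) ⟩
  - f x ℚ.+ - sumOver f xs            ≡⟨ ℚ.neg-distrib-+ (f x) (sumOver f xs) ⟨
  - (f x ℚ.+ sumOver f xs)            ∎

sumOver-zero : ∀ {A : Set} (xs : List A) → sumOver (λ _ → 0ℚ) xs ≡ 0ℚ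
sumOver-zero []       = refl
sumOver-zero (x ∷ xs) = trans (ℚ.+-identityˡ _) (sumOver-zero xs)

sumOver-+ : ∀ {A : Set} (f g : A → ℚ) xs →
  sumOver (λ x → f x ℚ.+ g x) xs ≡ sumOver f xs ℚ.+ sumOver g xs
sumOver-+ f g []       = refl
sumOver-+ f g (x ∷ xs) = begin
  (f x ℚ.+ g x) ℚ.+ sumOver (λ x → f x ℚ.+ g x) xs
    ≡⟨ cong (ℚ._+_ (f x ℚ.+ g x)) (sumOver-+ f g xs) ⟩
  (f x ℚ.+ g x) ℚ.+ (sumOver f xs ℚ.+ sumOver g xs)
    ≡⟨ interchange (CommutativeMonoid.commutativeSemigroup ℚ.+-0-commutativeMonoid)
                   (f x) (g x) (sumOver f xs) (sumOver g xs) ⟩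
  (f x ℚ.+ sumOver f xs) ℚ.+ (g x ℚ.+ sumOver g xs) ∎

sumOver-comm : ∀ {A B : Set} (f : A → B → ℚ) xs ys →
  sumOver (λ x → sumOver (f x) ys) xs ≡ sumOver (λ y → sumOver (λ x → f x y) xs) ys
sumOver-comm f []       ys = sym (sumOver-zero ys)
sumOver-comm f (x ∷ xs) ys = begin
  sumOver (f x) ys ℚ.+ sumOver (λ x → sumOver (f x) ys) xs
    ≡⟨ cong (ℚ._+_ (sumOver (f x) ys)) (sumOver-comm f xs ys) ⟩
  sumOver (f x) ys ℚ.+ sumOver (λ y → sumOver (λ x → f x y) xs) ys
    ≡⟨ sumOver-+ (f x) (λ y → sumOver (λ x → f x y) xs) ys ⟨
  sumOver (λ y → f x y ℚ.+ sumOver (λ x → f x y) xs) ys ∎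

-- pretwist u t unfolds to sumPairs (τ u) t.
sumPairs : {A : Set} → (A → A → ℚ) → List A → ℚ
sumPairs f xs = sumOver (λ a → sumOver (f a) xs) xs

sumPairs-map : ∀ {A B : Set} (f : B → B → ℚ) (g : A → B) xs →
  sumPairs f (map g xs) ≡ sumPairs (λ a b → f (g a) (g b)) xs
sumPairs-map f g xs = trans (sumOver-map (λ a → sumOver (f a) (map g xs)) g xs)
                            (sumOver-cong xs (λ {a} _ → sumOver-map (f (g a)) g xs))

sumPairs-cong : ∀ {A : Set} {f g : A → A → ℚ} xs →
  (∀ {a b} → a ∈ₗ xs → b ∈ₗ xs → f a b ≡ g a b) → sumPairs f xs ≡ sumPairs g xs
sumPairs-cong xs f≗g = sumOver-cong xs (λ a∈ → sumOver-cong xs (f≗g a∈))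

sumPairs-neg : ∀ {A : Set} (f : A → A → ℚ) xs →
  sumPairs (λ a b → - f a b) xs ≡ - sumPairs f xs
sumPairs-neg f xs = trans (sumOver-cong xs (λ {a} _ → sumOver-neg (f a) xs))
                          (sumOver-neg (λ a → sumOver (f a) xs) xs)

sumPairs-transpose : ∀ {A : Set} (f : A → A → ℚ) xs →
  sumPairs (λ a b → f b a) xs ≡ sumPairs f xs
sumPairs-transpose f xs = sym (sumOver-comm f xs xs)

Unique-head-disjoint : ∀ {d t d'} → Unique (concatMap cubes (d ∷ t)) → d' ∈ₗ t → Disjoint d d'
Unique-head-disjoint (a∉ ∷ _ ∷ _) d'∈t (here refl) c∈d' =
  All.lookup a∉ (there (∈-concatMap⁺ cubes (lose d'∈t c∈d'))) refl
Unique-head-disjoint (_ ∷ b∉ ∷ _) d'∈t (there (here refl)) c∈d' =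
  All.lookup b∉ (∈-concatMap⁺ cubes (lose d'∈t c∈d')) refl

equal-or-disjoint : ∀ {t d₀ d₁} → Unique (concatMap cubes t) →
  d₀ ∈ₗ t → d₁ ∈ₗ t → d₀ ≡ d₁ ⊎ Disjoint d₀ d₁
equal-or-disjoint _           (here refl) (here refl) = inj₁ refl
equal-or-disjoint unique      (here refl) (there d₁∈) = inj₂ (Unique-head-disjoint unique d₁∈)
equal-or-disjoint unique      (there d₀∈) (here refl) =
  inj₂ (Disjoint-sym (Unique-head-disjoint unique d₀∈))
equal-or-disjoint (_ ∷ _ ∷ unique) (there d₀∈) (there d₁∈) = equal-or-disjoint unique d₀∈ d₁∈

pretwist-reflect : ∀ w u t → pretwist u (reflectTiling w t) ≡ - pretwist (reflectDir w u) t
pretwist-reflect w u t = begin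
  sumPairs (τ u) (map (reflectDomino w) t)
    ≡⟨ sumPairs-map (τ u) (reflectDomino w) t ⟩
  sumPairs (λ d₀ d₁ → τ u (reflectDomino w d₀) (reflectDomino w d₁)) t
    ≡⟨ sumPairs-cong t (λ {d₀} {d₁} _ _ → τ-reflect w u d₀ d₁) ⟩
  sumPairs (λ d₀ d₁ → - τ (reflectDir w u) d₀ d₁) t
    ≡⟨ sumPairs-neg (τ (reflectDir w u)) t ⟩
  - pretwist (reflectDir w u) t ∎

pretwist-opposite : ∀ u t → Unique (concatMap cubes t) → pretwist (opposite u) t ≡ pretwist u t
pretwist-opposite u t unique = begin
  sumPairs (τ (opposite u)) t
    ≡⟨ sumPairs-cong t (λ d₀∈ d₁∈ → τ-opposite u (equal-or-disjoint unique d₀∈ d₁∈)) ⟩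
  sumPairs (λ d₀ d₁ → τ u d₁ d₀) t
    ≡⟨ sumPairs-transpose (τ u) t ⟩
  sumPairs (τ u) t ∎

lemma4p2 : (R : Region) (w : Axis) (t : List Domino) (u : Dir) →
    IsTiling R t →
    pretwist u (reflectTiling w t) ≡ - pretwist u t
lemma4p2 R w t u (_ , unique , _ , _) with reflectDir-fixes-or-reverses w u
... | inj₁ fixes = begin
  pretwist u (reflectTiling w t)   ≡⟨ pretwist-reflect w u t ⟩
  - pretwist (reflectDir w u) t    ≡⟨ cong (λ u' → - pretwist u' t) fixes ⟩
  - pretwist u t                   ∎
... | inj₂ reverses = begin
  pretwist u (reflectTiling w t)   ≡⟨ pretwist-reflect w u t ⟩
  - pretwist (reflectDir w u) t    ≡⟨ cong (λ u' → - pretwist u' t) reverses ⟩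
  - pretwist (opposite u) t        ≡⟨ cong -_ (pretwist-opposite u t unique) ⟩
  - pretwist u t                   ∎
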